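{- Let $n\ge2$ and $1\le s<n$ be integers and $b\ge1$ an integer. For every degree pattern $\mathbf d=(d_1,\dots,d_s)$ of integers with $d_1\ge\cdots\ge d_s\ge1$, $d_1\cdots d_s=b$ and $\mathbf d\ne\mathbf d^{(b)}:=(b,1,\dots,1)$, we have $|\mathbf D(\mathbf d^{(b)})|>|\mathbf D(\mathbf d)|$.
   Context: For a degree pattern $\mathbf d$, $D_i(\mathbf d)=\binom{d_i+n}{n}-1$ and $|\mathbf D(\mathbf d)|=D_1(\mathbf d)+\cdots+D_s(\mathbf d)$. -}

module Defs where

open import Data.Nat using (ℕ; zero; suc; _+_; _*_; _∸_; _≤_)
open import Data.Nat.Combinatorics using (_C_)
open import Data.Fin using (Fin; zero; suc)
import Data.Fin as F
open import Data.Vec using (Vec; lookup; tabulate; foldr; map)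

Dᵢ : ℕ → ℕ → ℕ
Dᵢ n dᵢ = ((dᵢ + n) C n) ∸ 1

|D| : ∀ {s} → ℕ → Vec ℕ s → ℕ
|D| n d = foldr _ _+_ 0 (map (Dᵢ n) d)

prod : ∀ {s} → Vec ℕ s → ℕ
prod d = foldr _ _*_ 1 d

NonIncreasing : ∀ {s} → Vec ℕ s → Set
NonIncreasing {s} d = ∀ (i j : Fin s) → i F.≤ j → lookup d j ≤ lookup d i

Positive : ∀ {s} → Vec ℕ s → Set
Positive {s} d = ∀ (i : Fin s) → 1 ≤ lookup d i

dᵇ : (s b : ℕ) → Vec ℕ s
dᵇ s b = tabulate λ { zero → b ; (suc _) → 1 }

module Submission where

-- Write g(m) = binom(m+n, n) and D(m) = g(m) - 1, so |D(d)| = Σᵢ D(dᵢ).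
-- The proof only uses that D is a strictly increasing convex sequence:
-- by Pascal's rule D(m+1) = D(m) + binom(m+n, n-1), and these increments
-- are positive and non-decreasing in m.
--
-- 1. For any such sequence f, convexity gives f(x) + f(y) ≤ f(x+y-1) + f(1),
--    and x+y-1 ≤ xy, so f(x) + f(y) ≤ f(xy) + f(1) for x, y ≥ 1, strictly
--    when x, y ≥ 2 (then x+y-1 < xy).
-- 2. Merging the entries of a positive vector one at a time yields
--    Σ f(vᵢ) + f(1) ≤ f(∏ vᵢ) + s·f(1), and the value of the right-hand side
--    is exactly Σ f over (b, 1, …, 1) plus f(1).
-- 3. If d ≠ (b, 1, …, 1), some tail entry dᵢ is ≥ 2; then also d₁ ≥ 2 and
--    d₂⋯d_s ≥ 2, so the first merge is strict, proving |D(d)| < |D(d^(b))|.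

open import Defs
open import Data.Nat using (ℕ; _≤_; _<_; _>_)
open import Data.Vec using (Vec)
open import Relation.Binary.PropositionalEquality using (_≡_; _≢_)

open import Data.Nat using (zero; suc; _+_; _*_; _∸_; z≤n; s≤s; _≤′_; ≤′-refl; ≤′-step; NonZero; >-nonZero)
open import Data.Nat.Properties
open import Data.Nat.Combinatorics using (_C_; nCk+nC[k+1]≡[n+1]C[k+1])
open import Data.Vec using ([]; _∷_; lookup; tabulate; foldr; map)
open import Data.Fin using (zero; suc)
open import Data.Product using (_,_; ∃)
open import Data.Empty using (⊥-elim)
open import Data.Sum using (_⊎_; inj₁; inj₂)
open import Relation.Binary.PropositionalEquality using (refl; sym; trans; cong; subst; module ≡-Reasoning)
open import Algebra.Properties.CommutativeSemigroup +-commutativeSemigroup using (xy∙z≈xz∙y)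

monotone : (u : ℕ → ℕ) → (∀ m → u m ≤ u (suc m)) → ∀ {a c} → a ≤ c → u a ≤ u c
monotone u up {a} a≤c = go (≤⇒≤′ a≤c)
  where
  go : ∀ {c} → a ≤′ c → u a ≤ u c
  go ≤′-refl       = ≤-refl
  go (≤′-step a≤c) = ≤-trans (go a≤c) (up _)

a+y≤[1+a]*y : ∀ a y .{{_ : NonZero y}} → a + y ≤ suc a * y
a+y≤[1+a]*y a y = begin
  a + y     ≡⟨ +-comm a y ⟩
  y + a     ≤⟨ +-monoʳ-≤ y (m≤m*n a y) ⟩
  y + a * y ∎
  where open ≤-Reasoning

a+y<[1+a]*y : ∀ a y .{{_ : NonZero a}} → 2 ≤ y → a + y < suc a * y
a+y<[1+a]*y a y 2≤y = begin-strict
  a + y     ≡⟨ +-comm a y ⟩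
  y + a     <⟨ +-monoʳ-< y (m<m*n a y 2≤y) ⟩
  y + a * y ∎
  where open ≤-Reasoning

sumOf : ∀ {s} → (ℕ → ℕ) → Vec ℕ s → ℕ
sumOf f v = foldr _ _+_ 0 (map f v)

-- The all-ones vector; d^(b) of length 1 + s is b followed by ones s.
ones : (s : ℕ) → Vec ℕ s
ones s = tabulate (λ _ → 1)

prod-ones : ∀ s → prod (ones s) ≡ 1
prod-ones zero    = refl
prod-ones (suc s) = cong (1 *_) (prod-ones s)

sumOf-ones : ∀ f s → sumOf f (ones s) ≡ s * f 1
sumOf-ones f zero    = refl
sumOf-ones f (suc s) = cong (f 1 +_) (sumOf-ones f s)

prod-pos : ∀ {s} (v : Vec ℕ s) → Positive v → 1 ≤ prod v
prod-pos []      _   = ≤-refl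
prod-pos (x ∷ v) pos = *-mono-≤ (pos zero) (prod-pos v (λ i → pos (suc i)))

entry≤prod : ∀ {s} (v : Vec ℕ s) → Positive v → ∀ i → lookup v i ≤ prod v
entry≤prod (x ∷ v) pos zero    = m≤m*n x (prod v) {{>-nonZero (prod-pos v (λ i → pos (suc i)))}}
entry≤prod (x ∷ v) pos (suc i) = ≤-trans (entry≤prod v (λ j → pos (suc j)) i)
                                         (m≤n*m (prod v) x {{>-nonZero (pos zero)}})

ones-or-large : ∀ {s} (v : Vec ℕ s) → Positive v → v ≡ ones s ⊎ ∃ λ i → 2 ≤ lookup v i
ones-or-large []                  _   = inj₁ refl
ones-or-large (suc zero ∷ v)      pos with ones-or-large v (λ i → pos (suc i))
... | inj₁ v≡ones      = inj₁ (cong (1 ∷_) v≡ones)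
... | inj₂ (i , large) = inj₂ (suc i , large)
ones-or-large (suc (suc x) ∷ v)   _   = inj₂ (zero , s≤s (s≤s z≤n))
ones-or-large (zero ∷ v)          pos with pos zero
... | ()

-- A strictly increasing convex sequence f, given by its positive,
-- non-decreasing increments δ.
module ConvexSequence (f δ : ℕ → ℕ)
  (step : ∀ m → f (suc m) ≡ f m + δ m)
  (δ-up : ∀ m → δ m ≤ δ (suc m))
  (δ-pos : ∀ m → 1 ≤ δ m) where

  f-suc : ∀ m → f m < f (suc m)
  f-suc m = begin-strict
    f m           <⟨ m<m+n (f m) (δ-pos m) ⟩
    f m + δ m     ≡⟨ sym (step m) ⟩
    f (suc m)     ∎
    where open ≤-Reasoning

  f-mono : ∀ {a c} → a ≤ c → f a ≤ f c
  f-mono = monotone f (λ m → <⇒≤ (f-suc m))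

  f-strict : ∀ {a c} → a < c → f a < f c
  f-strict {a} a<c = <-≤-trans (f-suc a) (f-mono a<c)

  shift : ∀ {a c} → a ≤ c → ∀ t → f (t + a) + f c ≤ f (t + c) + f a
  shift {a} {c} _   zero    = ≤-reflexive (+-comm (f a) (f c))
  shift {a} {c} a≤c (suc t) = begin
    f (suc t + a) + f c           ≡⟨ cong (_+ f c) (step (t + a)) ⟩
    f (t + a) + δ (t + a) + f c   ≡⟨ xy∙z≈xz∙y (f (t + a)) _ _ ⟩
    f (t + a) + f c + δ (t + a)   ≤⟨ +-mono-≤ (shift a≤c t) (monotone δ δ-up (+-monoʳ-≤ t a≤c)) ⟩
    f (t + c) + f a + δ (t + c)   ≡⟨ xy∙z≈xz∙y (f (t + c)) _ _ ⟩
    f (t + c) + δ (t + c) + f a   ≡⟨ cong (_+ f a) (sym (step (t + c))) ⟩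
    f (suc t + c) + f a           ∎
    where open ≤-Reasoning

  merge-sum : ∀ a y → 1 ≤ y → f (suc a) + f y ≤ f (a + y) + f 1
  merge-sum a y 1≤y = subst (λ z → f z + f y ≤ f (a + y) + f 1) (+-comm a 1) (shift 1≤y a)

  merge : ∀ {x y} → 1 ≤ x → 1 ≤ y → f x + f y ≤ f (x * y) + f 1
  merge {suc a} {y@(suc _)} _ 1≤y =
    ≤-trans (merge-sum a y 1≤y) (+-monoˡ-≤ (f 1) (f-mono (a+y≤[1+a]*y a y)))

  merge-strict : ∀ {x y} → 2 ≤ x → 2 ≤ y → f x + f y < f (x * y) + f 1
  merge-strict {suc a} {y} (s≤s 1≤a@(s≤s _)) 2≤y =
    ≤-<-trans (merge-sum a y (≤-trans (s≤s z≤n) 2≤y)) (+-monoˡ-< (f 1) (f-strict (a+y<[1+a]*y a y {{>-nonZero 1≤a}} 2≤y)))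

  cons-bound : ∀ {s} x (v : Vec ℕ s) → Positive v →
               sumOf f (x ∷ v) + f 1 ≤ f x + f (prod v) + s * f 1

  merge-all : ∀ {s} (v : Vec ℕ s) → Positive v → sumOf f v + f 1 ≤ f (prod v) + s * f 1
  merge-all []      _   = ≤-reflexive (sym (+-identityʳ (f 1)))
  merge-all {suc s} (x ∷ v) pos = begin
    sumOf f (x ∷ v) + f 1               ≤⟨ cons-bound x v (λ i → pos (suc i)) ⟩
    f x + f (prod v) + s * f 1          ≤⟨ +-monoˡ-≤ (s * f 1) (merge (pos zero) (prod-pos v (λ i → pos (suc i)))) ⟩
    f (x * prod v) + f 1 + s * f 1      ≡⟨ +-assoc (f (x * prod v)) _ _ ⟩
    f (prod (x ∷ v)) + suc s * f 1      ∎
    where open ≤-Reasoning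

  cons-bound {s} x v pos = begin
    f x + sumOf f v + f 1               ≡⟨ +-assoc (f x) _ _ ⟩
    f x + (sumOf f v + f 1)             ≤⟨ +-monoʳ-≤ (f x) (merge-all v pos) ⟩
    f x + (f (prod v) + s * f 1)        ≡⟨ sym (+-assoc (f x) _ _) ⟩
    f x + f (prod v) + s * f 1          ∎
    where open ≤-Reasoning

  merge-all-strict : ∀ {s} x (v : Vec ℕ s) → Positive v → 2 ≤ x → 2 ≤ prod v →
                     sumOf f (x ∷ v) + f 1 < f (prod (x ∷ v)) + suc s * f 1
  merge-all-strict {s} x v pos 2≤x 2≤prod = begin-strict
    sumOf f (x ∷ v) + f 1               ≤⟨ cons-bound x v pos ⟩
    f x + f (prod v) + s * f 1          <⟨ +-monoˡ-< (s * f 1) (merge-strict 2≤x 2≤prod) ⟩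
    f (x * prod v) + f 1 + s * f 1      ≡⟨ +-assoc (f (x * prod v)) _ _ ⟩
    f (prod (x ∷ v)) + suc s * f 1      ∎
    where open ≤-Reasoning

  sumOf-dᵇ : ∀ s b → sumOf f (dᵇ (suc s) b) + f 1 ≡ f b + suc s * f 1
  sumOf-dᵇ s b = begin
    f b + sumOf f (ones s) + f 1  ≡⟨ cong (λ z → f b + z + f 1) (sumOf-ones f s) ⟩
    f b + s * f 1 + f 1           ≡⟨ +-assoc (f b) _ _ ⟩
    f b + (s * f 1 + f 1)         ≡⟨ cong (f b +_) (+-comm (s * f 1) (f 1)) ⟩
    f b + suc s * f 1             ∎
    where open ≡-Reasoning

C-pos : ∀ m k → k ≤ m → 1 ≤ m C k
C-pos m       zero    _         = ≤-refl
C-pos (suc m) (suc k) (s≤s k≤m) =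
  subst (1 ≤_) (nCk+nC[k+1]≡[n+1]C[k+1] m k) (≤-trans (C-pos m k k≤m) (m≤m+n _ _))

C-up : ∀ m k → m C k ≤ suc m C k
C-up m zero    = ≤-refl
C-up m (suc k) = subst (m C suc k ≤_) (nCk+nC[k+1]≡[n+1]C[k+1] m k) (m≤n+m _ _)

-- D(m) = binom(m + n, n) - 1 with n = 1 + k is convex and strictly increasing:
-- its increments are δ(m) = binom(m + n, k), by Pascal's rule.
module BinomialSequence (k : ℕ) where

  δ : ℕ → ℕ
  δ m = (m + suc k) C k

  D-step : ∀ m → Dᵢ (suc k) (suc m) ≡ Dᵢ (suc k) m + δ m
  D-step m = begin
    ((suc m + suc k) C suc k) ∸ 1                  ≡⟨ cong (_∸ 1) (sym (nCk+nC[k+1]≡[n+1]C[k+1] (m + suc k) k)) ⟩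
    (δ m + (m + suc k) C suc k) ∸ 1                ≡⟨ cong (_∸ 1) (+-comm (δ m) _) ⟩
    ((m + suc k) C suc k + δ m) ∸ 1                ≡⟨ +-∸-comm (δ m) (C-pos (m + suc k) (suc k) (m≤n+m _ m)) ⟩
    Dᵢ (suc k) m + δ m                             ∎
    where open ≡-Reasoning

  δ-up : ∀ m → δ m ≤ δ (suc m)
  δ-up m = C-up (m + suc k) k

  δ-pos : ∀ m → 1 ≤ δ m
  δ-pos m = C-pos (m + suc k) k (≤-trans (n≤1+n k) (m≤n+m (suc k) m))

  open ConvexSequence (Dᵢ (suc k)) δ D-step δ-up δ-pos public

lemma5p1 : (n s b : ℕ) → 2 ≤ n → 1 ≤ s → s < n → 1 ≤ b →
    (d : Vec ℕ s) → NonIncreasing d → Positive d → prod d ≡ b →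
    d ≢ dᵇ s b →
    |D| n (dᵇ s b) > |D| n d
lemma5p1 (suc k) (suc s) _ _ _ _ _ (x ∷ v) noninc pos refl d≢dᵇ
  with ones-or-large v (λ i → pos (suc i))
... | inj₁ refl = ⊥-elim (d≢dᵇ (cong (_∷ ones s) x≡x*prod))
  where
  x≡x*prod : x ≡ x * prod (ones s)
  x≡x*prod = sym (trans (cong (x *_) (prod-ones s)) (*-identityʳ x))
... | inj₂ (i , 2≤vᵢ) = +-cancelʳ-< (Dᵢ (suc k) 1) _ _ (begin-strict
    |D| (suc k) (x ∷ v) + Dᵢ (suc k) 1                <⟨ merge-all-strict x v (λ j → pos (suc j)) 2≤x 2≤prod ⟩
    Dᵢ (suc k) (prod (x ∷ v)) + suc s * Dᵢ (suc k) 1  ≡⟨ sym (sumOf-dᵇ s (prod (x ∷ v))) ⟩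
    |D| (suc k) (dᵇ (suc s) (prod (x ∷ v))) + Dᵢ (suc k) 1 ∎)
  where
  open BinomialSequence k
  open ≤-Reasoning
  2≤x : 2 ≤ x
  2≤x = ≤-trans 2≤vᵢ (noninc zero (suc i) z≤n)
  2≤prod : 2 ≤ prod v
  2≤prod = ≤-trans 2≤vᵢ (entry≤prod v (λ j → pos (suc j)) i)
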